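{- Let $G$ be a finite group and $H$ a non-trivial normal subgroup of $G$. Let $\tau$ be an integer with $1\leq\tau\leq|H|$. If $\tau$ is even, then $H$ is a $(0,\tau)$-regular set of $G$.
   Context: All graphs are finite, undirected and simple. For a finite group $G$ and an inverse-closed subset $X\subseteq G\setminus\{1\}$, the Cayley graph $\mathrm{Cay}(G,X)$ has vertex set $G$ and edge set $\{\{g,gx\}: g\in G, x\in X\}$. For nonnegative integers $\kappa,\tau$, a subset $R$ of the vertex set of a graph $\Gamma$ is a $(\kappa,\tau)$-regular set of $\Gamma$ if every vertex in $R$ is adjacent to exactly $\kappa$ vertices of $R$ and every vertex outside $R$ is adjacent to exactly $\tau$ vertices of $R$. A subset $R\subseteq G$ is a $(\kappa,\tau)$-regular set of $G$ if there is a Cayley graph $\Gamma$ on $G$ such that $R$ is a $(\kappa,\tau)$-regular set of $\Gamma$. -}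

module Defs where

open import Data.Nat using (ℕ)
open import Data.Fin using (Fin)
open import Data.Fin.Subset using (Subset; _∈_; _∉_; _∩_; ∣_∣)
open import Data.Vec using (tabulate; lookup)
open import Data.Product using (Σ; _×_)
open import Relation.Binary.PropositionalEquality using (_≡_; _≢_)
open import Algebra.Structures using (IsGroup)

-- A finite group of order n, represented (up to isomorphism) on the carrier Fin n,
-- with propositional equality.
record FinGroup (n : ℕ) : Set where
  field
    _∙_     : Fin n → Fin n → Fin n
    ε       : Fin n
    _⁻¹     : Fin n → Fin n
    isGroup : IsGroup _≡_ _∙_ ε _⁻¹
  infixl 7 _∙_
  infix 8 _⁻¹

module _ {n : ℕ} (G : FinGroup n) where
  open FinGroup G

  record IsNormalSubgroup (H : Subset n) : Set where
    field
      ε∈H    : ε ∈ H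
      ∙-closed : ∀ {a b} → a ∈ H → b ∈ H → (a ∙ b) ∈ H
      ⁻¹-closed : ∀ {a} → a ∈ H → (a ⁻¹) ∈ H
      conj-closed : ∀ g {h} → h ∈ H → (g ∙ h ∙ g ⁻¹) ∈ H

  NonTrivial : Subset n → Set
  NonTrivial H = Σ (Fin n) λ h → h ∈ H × h ≢ ε

  record IsConnectionSet (X : Subset n) : Set where
    field
      ε∉X : ε ∉ X
      inv-closed : ∀ {x} → x ∈ X → (x ⁻¹) ∈ X

  -- Neighbourhood of g in Cay(G,X): {h | h = g x, x ∈ X} = {h | g⁻¹ h ∈ X}
  nbhd : Subset n → Fin n → Subset n
  nbhd X g = tabulate (λ h → lookup X (g ⁻¹ ∙ h))

  IsRegularSetOfCay : Subset n → ℕ → ℕ → Subset n → Set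
  IsRegularSetOfCay X κ τ R =
    ∀ g → (g ∈ R → ∣ R ∩ nbhd X g ∣ ≡ κ) × (g ∉ R → ∣ R ∩ nbhd X g ∣ ≡ τ)

  IsRegularSetOfGroup : ℕ → ℕ → Subset n → Set
  IsRegularSetOfGroup κ τ R =
    Σ (Subset n) λ X → IsConnectionSet X × IsRegularSetOfCay X κ τ R

{-# OPTIONS --safe #-}
module Submission where

-- For g ∉ H the neighbours of g lying in H correspond to the elements of X in the coset
-- g⁻¹H, so one needs an inverse-closed X ⊆ G ∖ H meeting every coset aH ≠ H in exactly τ
-- elements. As H is normal, inversion permutes the cosets, and G ∖ H splits into blocks
-- aH ∪ a⁻¹H. An inverse-closed set is a union of orbits of size 1 and 2, so it has
-- inverse-closed subsets of every even size up to its own. In a block that is a single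
-- coset take one of size τ; in a block of two cosets take one of size 2τ, which inversion
-- splits evenly between the two cosets. The choices are indexed by canonical block
-- representatives.

open import Algebra.Bundles using (Group)
import Algebra.Properties.CommutativeMonoid.Sum as CommutativeMonoidSum
import Algebra.Properties.Group as GroupProperties
open import Algebra.Structures using (IsGroup)
open import Data.Bool using (Bool; true; false; _∧_; not)
open import Data.Fin using (Fin; zero; suc; _≟_) renaming (_≤_ to _≤ᶠ_)
open import Data.Fin.Permutation using (Permutation′; _⟨$⟩ʳ_; permutation)
open import Data.Fin.Properties using (any?; ≤-antisym)
open import Data.Fin.Subset using (Subset; inside; outside; _∈_; _∉_; ∣_∣) renaming (_∩_ to _∩ˢ_)
open import Data.Fin.Subset.Properties using (_∈?_; x∈p∩q⁺; x∈p∩q⁻)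
open import Data.Nat using (ℕ; zero; suc; _+_; _*_; _≤_; _<_; z≤n; s≤s; s≤s⁻¹; ⌊_/2⌋)
open import Data.Nat.Divisibility using (_∣_; divides)
open import Data.Nat.Properties
  using (+-0-commutativeMonoid; ≤-trans; m≤n+m; +-comm; +-cancelˡ-≤; +-mono-≤; *-distribʳ-+;
         n≡⌊n+n/2⌋)
open import Data.Product using (∃; ∃₂; Σ; _,_; _×_; proj₁; proj₂)
open import Data.Sum using (_⊎_; inj₁; inj₂; [_,_])
open import Data.Vec using ([]; _∷_; tabulate)
open import Data.Vec.Properties using ([]=⇒lookup; lookup⇒[]=; lookup∘tabulate)
open import Function using (_∘_; id; mk⇔)
open import Level using (Level; 0ℓ)
open import Relation.Binary using (Rel; IsEquivalence) renaming (Decidable to Decidable₂)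
open import Relation.Binary.PropositionalEquality
  using (_≡_; _≢_; refl; sym; trans; cong; cong₂; subst; subst₂; module ≡-Reasoning)
open import Relation.Nullary using (does; yes; no; ¬_; contradiction)
open import Relation.Nullary.Decidable using (does-⇔; dec-true; dec-false; _×-dec_; _⊎-dec_; ¬?)
open import Relation.Unary using (Pred; Decidable; Empty; Satisfiable; _⊆_; _∩_; _∪_; ∁; ｛_｝; ∅)
open import Relation.Unary.Properties using (_∩?_; _∪?_; ∁?; ∅?)

open import Defs
open CommutativeMonoidSum +-0-commutativeMonoid
  using (sum; sum-cong-≗; ∑-distrib-+; sum-permute; sum-replicate-zero)

private variable
  n : ℕ
  ℓ ℓ′ : Level
  P : Pred (Fin n) ℓ
  Q : Pred (Fin n) ℓ′

𝟙 : Bool → ℕ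
𝟙 true = 1
𝟙 false = 0

count : {P : Pred (Fin n) ℓ} → Decidable P → ℕ
count P? = sum (λ i → 𝟙 (does (P? i)))

count-cong : ∀ {n} {P : Pred (Fin n) ℓ} {Q : Pred (Fin n) ℓ′}
             (P? : Decidable P) (Q? : Decidable Q) → P ⊆ Q → Q ⊆ P → count P? ≡ count Q?
count-cong {n = n} P? Q? P⊆Q Q⊆P =
  sum-cong-≗ {n} λ i → cong 𝟙 (does-⇔ (mk⇔ P⊆Q Q⊆P) (P? i) (Q? i))

count-partition : ∀ {n} {P : Pred (Fin n) ℓ} {Q : Pred (Fin n) ℓ′}
                  (P? : Decidable P) (Q? : Decidable Q) →
                  count P? ≡ count (P? ∩? Q?) + count (P? ∩? ∁? Q?)
count-partition {n = n} P? Q? =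
  trans (sum-cong-≗ {n} λ i → 𝟙-split (does (P? i)) (does (Q? i))) (∑-distrib-+ {n} _ _)
  where
  𝟙-split : ∀ a b → 𝟙 a ≡ 𝟙 (a ∧ b) + 𝟙 (a ∧ not b)
  𝟙-split true  true  = refl
  𝟙-split true  false = refl
  𝟙-split false _     = refl

count-permute : (P? : Decidable P) (π : Permutation′ n) → count (P? ∘ (π ⟨$⟩ʳ_)) ≡ count P?
count-permute P? π = sym (sum-permute _ π)

count-∅ : ∀ {n} {P : Pred (Fin n) ℓ} (P? : Decidable P) → Empty P → count P? ≡ 0
count-∅ {n = n} P? ∅ =
  trans (sum-cong-≗ {n} λ i → cong 𝟙 (dec-false (P? i) (∅ i))) (sum-replicate-zero n)

count-satisfiable : (P? : Decidable P) → 0 < count P? → Satisfiable P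
count-satisfiable P? 0<count with any? P?
... | yes ∃P = ∃P
... | no  ∄P with () ← subst (0 <_) (count-∅ P? λ i Pi → ∄P (i , Pi)) 0<count

count-｛｝ : ∀ {n} (x : Fin n) → count (x ≟_) ≡ 1
count-｛｝ {n = suc n} zero    = cong suc (count-∅ {n = n} (λ i → zero ≟ suc i) λ _ ())
count-｛｝ {n = suc n} (suc x) = count-｛｝ x

count-remove : (P? : Decidable P) {x : Fin n} → P x → count P? ≡ suc (count (P? ∩? ∁? (x ≟_)))
count-remove P? {x} Px = trans (count-partition P? (x ≟_))
  (cong (_+ count (P? ∩? ∁? (x ≟_)))
        (trans (count-cong (P? ∩? (x ≟_)) (x ≟_) proj₂ λ { refl → Px , refl }) (count-｛｝ x)))

count-insert : (P? : Decidable P) {x : Fin n} → ¬ P x → count (P? ∪? (x ≟_)) ≡ suc (count P?)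
count-insert {P = P} P? {x} ¬Px = trans (count-remove (P? ∪? (x ≟_)) (inj₂ refl))
  (cong suc (count-cong ((P? ∪? (x ≟_)) ∩? ∁? (x ≟_)) P? shrink extend))
  where
  shrink : (P ∪ ｛ x ｝) ∩ ∁ ｛ x ｝ ⊆ P
  shrink (inj₁ Py , _)   = Py
  shrink (inj₂ x≡y , x≢y) = contradiction x≡y x≢y
  extend : P ⊆ (P ∪ ｛ x ｝) ∩ ∁ ｛ x ｝
  extend Py = inj₁ Py , λ { refl → ¬Px Py }

count-⊆ : (P? : Decidable P) (Q? : Decidable Q) → Q ⊆ P →
          count P? ≡ count Q? + count (P? ∩? ∁? Q?)
count-⊆ P? Q? Q⊆P = trans (count-partition P? Q?)
  (cong (_+ count (P? ∩? ∁? Q?)) (count-cong (P? ∩? Q?) Q? proj₂ λ Qx → Q⊆P Qx , Qx))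

count-∖-≥ : (P? : Decidable P) (Q? : Decidable Q) → Q ⊆ P → ∀ {m} →
            m + count Q? ≤ count P? → m ≤ count (P? ∩? ∁? Q?)
count-∖-≥ P? Q? Q⊆P {m} bound =
  +-cancelˡ-≤ (count Q?) m _ (subst₂ _≤_ (+-comm m (count Q?)) (count-⊆ P? Q? Q⊆P) bound)

count-insert-pair : (P? : Decidable P) {a b : Fin n} → ¬ P a → ¬ P b → a ≢ b →
                    count (P? ∪? ((a ≟_) ∪? (b ≟_))) ≡ 2 + count P?
count-insert-pair {P = P} P? {a} {b} ¬Pa ¬Pb a≢b = begin
  count (P? ∪? ((a ≟_) ∪? (b ≟_)))  ≡⟨ count-cong (P? ∪? ((a ≟_) ∪? (b ≟_))) ((P? ∪? (a ≟_)) ∪? (b ≟_))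
                                                   assocˡ assocʳ ⟩
  count ((P? ∪? (a ≟_)) ∪? (b ≟_))  ≡⟨ count-insert (P? ∪? (a ≟_)) [ ¬Pb , a≢b ] ⟩
  suc (count (P? ∪? (a ≟_)))        ≡⟨ cong suc (count-insert P? ¬Pa) ⟩
  2 + count P?                      ∎
  where
  open ≡-Reasoning
  assocˡ : P ∪ (｛ a ｝ ∪ ｛ b ｝) ⊆ (P ∪ ｛ a ｝) ∪ ｛ b ｝
  assocˡ = [ inj₁ ∘ inj₁ , [ inj₁ ∘ inj₂ , inj₂ ] ]
  assocʳ : (P ∪ ｛ a ｝) ∪ ｛ b ｝ ⊆ P ∪ (｛ a ｝ ∪ ｛ b ｝)
  assocʳ = [ [ inj₁ , inj₂ ∘ inj₁ ] , inj₂ ∘ inj₂ ]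

∣p∣≡count : (p : Subset n) → ∣ p ∣ ≡ count (_∈? p)
∣p∣≡count []            = refl
∣p∣≡count (inside  ∷ p) = cong suc (∣p∣≡count p)
∣p∣≡count (outside ∷ p) = ∣p∣≡count p

∈-tabulate⁺ : ∀ {f : Fin n → Bool} {x} → f x ≡ true → x ∈ tabulate f
∈-tabulate⁺ {f = f} {x} fx = lookup⇒[]= x (tabulate f) (trans (lookup∘tabulate f x) fx)

∈-tabulate⁻ : ∀ {f : Fin n → Bool} {x} → x ∈ tabulate f → f x ≡ true
∈-tabulate⁻ {f = f} {x} x∈ = trans (sym (lookup∘tabulate f x)) ([]=⇒lookup x∈)

toSubset : {P : Pred (Fin n) ℓ} → Decidable P → Subset n
toSubset P? = tabulate (does ∘ P?)

∈-toSubset⁺ : {P : Pred (Fin n) ℓ} (P? : Decidable P) {x : Fin n} → P x → x ∈ toSubset P?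
∈-toSubset⁺ P? {x} Px = ∈-tabulate⁺ (dec-true (P? x) Px)

∈-toSubset⁻ : {P : Pred (Fin n) ℓ} (P? : Decidable P) {x : Fin n} → x ∈ toSubset P? → P x
∈-toSubset⁻ P? {x} x∈ with P? x | ∈-tabulate⁻ x∈
... | yes Px | _  = Px
... | no  _  | ()

module InvolutionClosed {n : ℕ} (ι : Fin n → Fin n) (ι-involutive : ∀ x → ι (ι x) ≡ x) where

  Closed : Pred (Fin n) ℓ → Set ℓ
  Closed P = ∀ x → P x → P (ι x)

  closed-∪ : {P Q : Pred (Fin n) ℓ} → Closed P → Closed Q → Closed (P ∪ Q)
  closed-∪ closedP closedQ x = [ inj₁ ∘ closedP x , inj₂ ∘ closedQ x ]

  closed-∩ : {P Q : Pred (Fin n) ℓ} → Closed P → Closed Q → Closed (P ∩ Q)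
  closed-∩ closedP closedQ x (Px , Qx) = closedP x Px , closedQ x Qx

  closed-∁ : {P : Pred (Fin n) ℓ} → Closed P → Closed (∁ P)
  closed-∁ {P = P} closedP x ¬Px Pιx = ¬Px (subst P (ι-involutive x) (closedP (ι x) Pιx))

  closed-｛｝ : ∀ x → ι x ≡ x → Closed ｛ x ｝
  closed-｛｝ x ιx≡x _ refl = sym ιx≡x

  closed-orbit : ∀ x → Closed (｛ x ｝ ∪ ｛ ι x ｝)
  closed-orbit x _ (inj₁ refl) = inj₂ refl
  closed-orbit x _ (inj₂ refl) = inj₁ (sym (ι-involutive x))

  count-∩-transport : {T A B : Pred (Fin n) 0ℓ}
                      (T? : Decidable T) (A? : Decidable A) (B? : Decidable B) →
                      Closed T → A ∘ ι ⊆ B → B ⊆ A ∘ ι → count (T? ∩? A?) ≡ count (T? ∩? B?)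
  count-∩-transport {T} {A} {B} T? A? B? closedT Aι⊆B B⊆Aι = begin
    count (T? ∩? A?)        ≡⟨ count-permute (T? ∩? A?) (permutation ι ι ι-involutive ι-involutive) ⟨
    count ((T? ∩? A?) ∘ ι)  ≡⟨ count-cong ((T? ∩? A?) ∘ ι) (T? ∩? B?) shift unshift ⟩
    count (T? ∩? B?)        ∎
    where
    open ≡-Reasoning
    shift : (T ∩ A) ∘ ι ⊆ T ∩ B
    shift {x} (Tιx , Aιx) = subst T (ι-involutive x) (closedT (ι x) Tιx) , Aι⊆B Aιx
    unshift : T ∩ B ⊆ (T ∩ A) ∘ ι
    unshift {x} (Tx , Bx) = closedT x Tx , B⊆Aι Bx

  closed-pair : {U : Pred (Fin n) 0ℓ} (U? : Decidable U) → Closed U → 2 ≤ count U? →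
                ∃₂ λ a b → U a × U b × a ≢ b × Closed (｛ a ｝ ∪ ｛ b ｝)
  closed-pair U? closedU 2≤count with count-satisfiable U? (≤-trans (s≤s z≤n) 2≤count)
  ... | x , Ux with ι x ≟ x
  ...   | no ιx≢x = x , ι x , Ux , closedU x Ux , ιx≢x ∘ sym , closed-orbit x
  ...   | yes ιx≡x
          with count-satisfiable (U? ∩? ∁? (x ≟_)) (s≤s⁻¹ (subst (2 ≤_) (count-remove U? Ux) 2≤count))
  ...     | y , Uy , x≢y with ι y ≟ y
  ...       | yes ιy≡y =
              x , y , Ux , Uy , x≢y , closed-∪ (closed-｛｝ x ιx≡x) (closed-｛｝ y ιy≡y)
  ...       | no  ιy≢y = y , ι y , Uy , closedU y Uy , ιy≢y ∘ sym , closed-orbit y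

  ClosedSubset : Pred (Fin n) 0ℓ → ℕ → Set₁
  ClosedSubset S m =
    Σ (Pred (Fin n) 0ℓ) λ T → Σ (Decidable T) λ T? → Closed T × T ⊆ S × count T? ≡ m

  closed-extend : {S T : Pred (Fin n) 0ℓ} (S? : Decidable S) (T? : Decidable T) →
                  Closed S → Closed T → T ⊆ S → ∀ {m} → count T? ≡ m → 2 + m ≤ count S? →
                  ClosedSubset S (2 + m)
  closed-extend {S} {T} S? T? closedS closedT T⊆S countT bound
    with closed-pair (S? ∩? ∁? T?) (closed-∩ closedS (closed-∁ closedT))
                     (count-∖-≥ S? T? T⊆S (subst ((_≤ count S?) ∘ (2 +_)) (sym countT) bound))
  ... | a , b , (Sa , ¬Ta) , (Sb , ¬Tb) , a≢b , closedab =
    T ∪ (｛ a ｝ ∪ ｛ b ｝) , T? ∪? ((a ≟_) ∪? (b ≟_)) , closed-∪ closedT closedab ,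
    [ T⊆S , [ (λ { refl → Sa }) , (λ { refl → Sb }) ] ] ,
    trans (count-insert-pair T? ¬Ta ¬Tb a≢b) (cong (2 +_) countT)

  closed-even-subset : {S : Pred (Fin n) 0ℓ} (S? : Decidable S) → Closed S →
                       ∀ q → q * 2 ≤ count S? → ClosedSubset S (q * 2)
  closed-even-subset S? closedS zero _ = ∅ , ∅? , (λ _ ()) , (λ ()) , count-∅ {n = n} ∅? λ _ ()
  closed-even-subset S? closedS (suc q) bound
    with closed-even-subset S? closedS q (≤-trans (m≤n+m (q * 2) 2) bound)
  ... | T , T? , closedT , T⊆S , countT = closed-extend S? T? closedS closedT T⊆S countT bound

least : ∀ {n} {P : Pred (Fin n) ℓ} → Decidable P → Satisfiable P →
        ∃ λ i → P i × ∀ {j} → P j → i ≤ᶠ j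
least {n = suc n} P? (i , Pi) with P? zero
... | yes P0 = zero , P0 , λ _ → z≤n
least {n = suc n} P? (zero  , P0) | no ¬P0 = contradiction P0 ¬P0
least {n = suc n} {P = P} P? (suc i , Pi) | no ¬P0 with least (P? ∘ suc) (i , Pi)
... | j , Pj , j-least = suc j , Pj , suc-j-least
  where
  suc-j-least : ∀ {k} → P k → suc j ≤ᶠ k
  suc-j-least {zero}  P0 = contradiction P0 ¬P0
  suc-j-least {suc k} Pk = s≤s (j-least Pk)

module Representative {n : ℕ} {_≈_ : Rel (Fin n) ℓ}
                      (≈-isEquivalence : IsEquivalence _≈_) (_≈?_ : Decidable₂ _≈_) where
  open IsEquivalence ≈-isEquivalence renaming (refl to ≈-refl; sym to ≈-sym; trans to ≈-trans)

  private
    least-related : ∀ x → ∃ λ r → x ≈ r × ∀ {j} → x ≈ j → r ≤ᶠ j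
    least-related x = least (x ≈?_) (x , ≈-refl)

  rep : Fin n → Fin n
  rep x = proj₁ (least-related x)

  rep-related : ∀ x → x ≈ rep x
  rep-related x = proj₁ (proj₂ (least-related x))

  rep-least : ∀ {x y} → x ≈ y → rep x ≤ᶠ y
  rep-least {x} = proj₂ (proj₂ (least-related x))

  rep-cong : ∀ {x y} → x ≈ y → rep x ≡ rep y
  rep-cong {x} {y} x≈y = ≤-antisym (rep-least (≈-trans x≈y (rep-related y)))
                                   (rep-least (≈-trans (≈-sym x≈y) (rep-related x)))

module Cosets {n : ℕ} (G : FinGroup n) {H : Subset n} (H-normal : IsNormalSubgroup G H) where
  open FinGroup G
  open IsGroup isGroup using (assoc; inverseˡ)
  open IsNormalSubgroup H-normal

  group : Group 0ℓ 0ℓ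
  group = record
    { Carrier = Fin n ; _≈_ = _≡_ ; _∙_ = _∙_ ; ε = ε ; _⁻¹ = _⁻¹ ; isGroup = isGroup }

  open GroupProperties group
    using (⁻¹-involutive; ⁻¹-anti-homo-∙; \\-leftDividesˡ; \\-leftDividesʳ; //-rightDividesʳ)

  infix 4 _∼_ _∼?_
  _∼_ : Rel (Fin n) 0ℓ
  a ∼ b = a ⁻¹ ∙ b ∈ H

  _∼?_ : Decidable₂ _∼_
  a ∼? b = a ⁻¹ ∙ b ∈? H

  ∼-refl : ∀ {a} → a ∼ a
  ∼-refl {a} = subst (_∈ H) (sym (inverseˡ a)) ε∈H

  ⁻¹-∙-swap : ∀ a b → (a ⁻¹ ∙ b) ⁻¹ ≡ b ⁻¹ ∙ a
  ⁻¹-∙-swap a b = trans (⁻¹-anti-homo-∙ (a ⁻¹) b) (cong (b ⁻¹ ∙_) (⁻¹-involutive a))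

  ∼-sym : ∀ {a b} → a ∼ b → b ∼ a
  ∼-sym {a} {b} a∼b = subst (_∈ H) (⁻¹-∙-swap a b) (⁻¹-closed a∼b)

  ∼-trans : ∀ {a b c} → a ∼ b → b ∼ c → a ∼ c
  ∼-trans {a} {b} {c} a∼b b∼c = subst (_∈ H) cancel (∙-closed a∼b b∼c)
    where
    cancel : a ⁻¹ ∙ b ∙ (b ⁻¹ ∙ c) ≡ a ⁻¹ ∙ c
    cancel = trans (assoc (a ⁻¹) b (b ⁻¹ ∙ c)) (cong (a ⁻¹ ∙_) (\\-leftDividesˡ b c))

  ∼-⁻¹ : ∀ {a b} → a ∼ b → a ⁻¹ ∼ b ⁻¹
  ∼-⁻¹ {a} {b} a∼b = subst (_∈ H) conjugate (conj-closed a (⁻¹-closed a∼b))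
    where
    open ≡-Reasoning
    conjugate : a ∙ (a ⁻¹ ∙ b) ⁻¹ ∙ a ⁻¹ ≡ a ⁻¹ ⁻¹ ∙ b ⁻¹
    conjugate = begin
      a ∙ (a ⁻¹ ∙ b) ⁻¹ ∙ a ⁻¹  ≡⟨ cong (λ x → a ∙ x ∙ a ⁻¹) (⁻¹-∙-swap a b) ⟩
      a ∙ (b ⁻¹ ∙ a) ∙ a ⁻¹     ≡⟨ cong (_∙ a ⁻¹) (assoc a (b ⁻¹) a) ⟨
      a ∙ b ⁻¹ ∙ a ∙ a ⁻¹       ≡⟨ //-rightDividesʳ a (a ∙ b ⁻¹) ⟩
      a ∙ b ⁻¹                  ≡⟨ cong (_∙ b ⁻¹) (⁻¹-involutive a) ⟨
      a ⁻¹ ⁻¹ ∙ b ⁻¹            ∎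

  ∼-isEquivalence : IsEquivalence _∼_
  ∼-isEquivalence = record { refl = ∼-refl ; sym = ∼-sym ; trans = ∼-trans }

  ⁻¹∼⇒∼⁻¹ : ∀ {a b} → a ⁻¹ ∼ b → a ∼ b ⁻¹
  ⁻¹∼⇒∼⁻¹ {a} {b} = subst (_∼ b ⁻¹) (⁻¹-involutive a) ∘ ∼-⁻¹

  ∼⁻¹⇒⁻¹∼ : ∀ {a b} → a ∼ b ⁻¹ → a ⁻¹ ∼ b
  ∼⁻¹⇒⁻¹∼ {a} {b} = subst (a ⁻¹ ∼_) (⁻¹-involutive b) ∘ ∼-⁻¹

  ∼-∈ : ∀ {a b} → a ∼ b → a ∈ H → b ∈ H
  ∼-∈ {a} {b} a∼b a∈H = subst (_∈ H) (\\-leftDividesˡ a b) (∙-closed a∈H a∼b)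

  ∈-⁻¹ : ∀ {a} → a ⁻¹ ∈ H → a ∈ H
  ∈-⁻¹ {a} = subst (_∈ H) (⁻¹-involutive a) ∘ ⁻¹-closed

  -- a ≃ b iff b ∈ aH ∪ a⁻¹H: the classes are the orbits of inversion on G/H.
  infix 4 _≃_ _≃?_
  _≃_ : Rel (Fin n) 0ℓ
  a ≃ b = a ∼ b ⊎ a ⁻¹ ∼ b

  _≃?_ : Decidable₂ _≃_
  a ≃? b = a ∼? b ⊎-dec a ⁻¹ ∼? b

  ≃-sym : ∀ {a b} → a ≃ b → b ≃ a
  ≃-sym (inj₁ a∼b)   = inj₁ (∼-sym a∼b)
  ≃-sym (inj₂ a⁻¹∼b) = inj₂ (∼-sym (⁻¹∼⇒∼⁻¹ a⁻¹∼b))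

  ≃-trans : ∀ {a b c} → a ≃ b → b ≃ c → a ≃ c
  ≃-trans (inj₁ a∼b)   (inj₁ b∼c)   = inj₁ (∼-trans a∼b b∼c)
  ≃-trans (inj₁ a∼b)   (inj₂ b⁻¹∼c) = inj₂ (∼-trans (∼-⁻¹ a∼b) b⁻¹∼c)
  ≃-trans (inj₂ a⁻¹∼b) (inj₁ b∼c)   = inj₂ (∼-trans a⁻¹∼b b∼c)
  ≃-trans (inj₂ a⁻¹∼b) (inj₂ b⁻¹∼c) = inj₁ (∼-trans (⁻¹∼⇒∼⁻¹ a⁻¹∼b) b⁻¹∼c)

  ≃-isEquivalence : IsEquivalence _≃_
  ≃-isEquivalence = record { refl = inj₁ ∼-refl ; sym = ≃-sym ; trans = ≃-trans }

  ≃-⁻¹ : ∀ {a b} → a ≃ b → a ≃ b ⁻¹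
  ≃-⁻¹ (inj₁ a∼b)   = inj₂ (∼-⁻¹ a∼b)
  ≃-⁻¹ (inj₂ a⁻¹∼b) = inj₁ (⁻¹∼⇒∼⁻¹ a⁻¹∼b)

  translation : Fin n → Permutation′ n
  translation a = permutation (a ∙_) (a ⁻¹ ∙_) (\\-leftDividesˡ a) (\\-leftDividesʳ a)

  count-coset : ∀ a → count (a ∼?_) ≡ ∣ H ∣
  count-coset a = begin
    count (a ∼?_)             ≡⟨ count-permute (a ∼?_) (translation a) ⟨
    count ((a ∼?_) ∘ (a ∙_))  ≡⟨ count-cong ((a ∼?_) ∘ (a ∙_)) (_∈? H) cancel uncancel ⟩
    count (_∈? H)             ≡⟨ ∣p∣≡count H ⟨
    ∣ H ∣                     ∎
    where
    open ≡-Reasoning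
    cancel : (a ∼_) ∘ (a ∙_) ⊆ (_∈ H)
    cancel = subst (_∈ H) (\\-leftDividesʳ a _)
    uncancel : (_∈ H) ⊆ (a ∼_) ∘ (a ∙_)
    uncancel = subst (_∈ H) (sym (\\-leftDividesʳ a _))

  count-block-selfInverse : ∀ {a} → a ∼ a ⁻¹ → count (a ≃?_) ≡ ∣ H ∣
  count-block-selfInverse {a} a∼a⁻¹ =
    trans (count-cong (a ≃?_) (a ∼?_) [ id , ∼-trans a∼a⁻¹ ] inj₁) (count-coset a)

  ≃-∖-∼ : ∀ {a b} → a ≃ b → ¬ a ∼ b → a ⁻¹ ∼ b
  ≃-∖-∼ (inj₁ a∼b)   a≁b = contradiction a∼b a≁b
  ≃-∖-∼ (inj₂ a⁻¹∼b) _   = a⁻¹∼b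

  cosets-disjoint : ∀ {a b} → ¬ a ∼ a ⁻¹ → a ⁻¹ ∼ b → ¬ a ∼ b
  cosets-disjoint a≁a⁻¹ a⁻¹∼b a∼b = a≁a⁻¹ (∼-trans a∼b (∼-sym a⁻¹∼b))

  count-block-¬selfInverse : ∀ {a} → ¬ a ∼ a ⁻¹ → count (a ≃?_) ≡ ∣ H ∣ + ∣ H ∣
  count-block-¬selfInverse {a} a≁a⁻¹ = trans (count-partition (a ≃?_) (a ∼?_)) (cong₂ _+_
    (trans (count-cong ((a ≃?_) ∩? (a ∼?_)) (a ∼?_) proj₂ λ a∼b → inj₁ a∼b , a∼b) (count-coset a))
    (trans (count-cong ((a ≃?_) ∩? ∁? (a ∼?_)) (a ⁻¹ ∼?_) (λ (a≃b , a≁b) → ≃-∖-∼ a≃b a≁b)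
                       λ a⁻¹∼b → inj₂ a⁻¹∼b , cosets-disjoint a≁a⁻¹ a⁻¹∼b)
           (count-coset (a ⁻¹))))

  open InvolutionClosed _⁻¹ ⁻¹-involutive public

  module _ {T : Pred (Fin n) 0ℓ} (T? : Decidable T) where

    count-∩-coset⁻¹ : Closed T → ∀ a → count (T? ∩? (a ∼?_)) ≡ count (T? ∩? (a ⁻¹ ∼?_))
    count-∩-coset⁻¹ closedT a = count-∩-transport T? (a ∼?_) (a ⁻¹ ∼?_) closedT ∼⁻¹⇒⁻¹∼ ⁻¹∼⇒∼⁻¹

    count-∩-coset-cong : ∀ {a b} → a ∼ b → count (T? ∩? (a ∼?_)) ≡ count (T? ∩? (b ∼?_))
    count-∩-coset-cong {a} {b} a∼b = count-cong (T? ∩? (a ∼?_)) (T? ∩? (b ∼?_))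
      (λ (Tx , a∼x) → Tx , ∼-trans (∼-sym a∼b) a∼x) (λ (Tx , b∼x) → Tx , ∼-trans a∼b b∼x)

    count-∩-block-cong : Closed T → ∀ {a b} → a ≃ b →
                         count (T? ∩? (a ∼?_)) ≡ count (T? ∩? (b ∼?_))
    count-∩-block-cong closedT     (inj₁ a∼b)   = count-∩-coset-cong a∼b
    count-∩-block-cong closedT {a} (inj₂ a⁻¹∼b) =
      trans (count-∩-coset⁻¹ closedT a) (count-∩-coset-cong a⁻¹∼b)

    count-two-coset-block : Closed T → ∀ {a} → ¬ a ∼ a ⁻¹ → T ⊆ (a ≃_) →
                            count T? ≡ count (T? ∩? (a ∼?_)) + count (T? ∩? (a ∼?_))
    count-two-coset-block closedT {a} a≁a⁻¹ T⊆block = begin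
      count T?                          ≡⟨ count-partition T? (a ∼?_) ⟩
      c + count (T? ∩? ∁? (a ∼?_))      ≡⟨ cong (c +_) (count-cong (T? ∩? ∁? (a ∼?_)) (T? ∩? (a ⁻¹ ∼?_))
                                                                    other-coset in-block) ⟩
      c + count (T? ∩? (a ⁻¹ ∼?_))      ≡⟨ cong (c +_) (count-∩-coset⁻¹ closedT a) ⟨
      c + c                             ∎
      where
      open ≡-Reasoning
      c : ℕ
      c = count (T? ∩? (a ∼?_))
      other-coset : T ∩ ∁ (a ∼_) ⊆ T ∩ (a ⁻¹ ∼_)
      other-coset (Tx , a≁x) = Tx , ≃-∖-∼ (T⊆block Tx) a≁x
      in-block : T ∩ (a ⁻¹ ∼_) ⊆ T ∩ ∁ (a ∼_)
      in-block (Tx , a⁻¹∼x) = Tx , cosets-disjoint a≁a⁻¹ a⁻¹∼x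

  ∈-nbhd⁺ : ∀ {X g h} → g ⁻¹ ∙ h ∈ X → h ∈ nbhd G X g
  ∈-nbhd⁺ {X} {g} {h} x∈ = ∈-tabulate⁺ ([]=⇒lookup x∈)

  ∈-nbhd⁻ : ∀ {X g h} → h ∈ nbhd G X g → g ⁻¹ ∙ h ∈ X
  ∈-nbhd⁻ {X} {g} {h} h∈ = lookup⇒[]= (g ⁻¹ ∙ h) X (∈-tabulate⁻ h∈)

  neighbours-in-H : {X : Pred (Fin n) 0ℓ} (X? : Decidable X) (g : Fin n) →
                    ∣ H ∩ˢ nbhd G (toSubset X?) g ∣ ≡ count ((g ⁻¹ ∼?_) ∩? X?)
  neighbours-in-H {X} X? g = begin
    ∣ H ∩ˢ N ∣                 ≡⟨ ∣p∣≡count (H ∩ˢ N) ⟩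
    count (_∈? H ∩ˢ N)         ≡⟨ count-cong (_∈? H ∩ˢ N) (P? ∘ (g ⁻¹ ∙_)) to from ⟩
    count (P? ∘ (g ⁻¹ ∙_))     ≡⟨ count-permute P? (translation (g ⁻¹)) ⟩
    count P?                   ∎
    where
    open ≡-Reasoning
    N : Subset n
    N = nbhd G (toSubset X?) g
    P? : Decidable ((g ⁻¹ ∼_) ∩ X)
    P? = (g ⁻¹ ∼?_) ∩? X?
    to : (_∈ H ∩ˢ N) ⊆ ((g ⁻¹ ∼_) ∩ X) ∘ (g ⁻¹ ∙_)
    to {h} h∈ with x∈p∩q⁻ H N h∈
    ... | h∈H , h∈N = subst (_∈ H) (sym (\\-leftDividesʳ (g ⁻¹) h)) h∈H ,
                      ∈-toSubset⁻ X? (∈-nbhd⁻ h∈N)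
    from : ((g ⁻¹ ∼_) ∩ X) ∘ (g ⁻¹ ∙_) ⊆ (_∈ H ∩ˢ N)
    from {h} (g⁻¹∼g⁻¹h , Xg⁻¹h) = x∈p∩q⁺ (subst (_∈ H) (\\-leftDividesʳ (g ⁻¹) h) g⁻¹∼g⁻¹h ,
                                          ∈-nbhd⁺ (∈-toSubset⁺ X? Xg⁻¹h))

module Construction {n : ℕ} (G : FinGroup n) {H : Subset n} (H-normal : IsNormalSubgroup G H)
                    (k : ℕ) (2k≤∣H∣ : k * 2 ≤ ∣ H ∣) where
  open FinGroup G
  open IsNormalSubgroup H-normal
  open Cosets G H-normal

  record Selection (a : Fin n) : Set₁ where
    field
      S             : Pred (Fin n) 0ℓ
      S?            : Decidable S
      closed        : Closed S
      ⊆block        : S ⊆ (a ≃_)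
      count-∩-coset : count (S? ∩? (a ∼?_)) ≡ k * 2

  selection : ∀ a → Selection a
  selection a with a ∼? a ⁻¹
  ... | yes a∼a⁻¹
    with closed-even-subset (a ≃?_) (λ _ → ≃-⁻¹) k
           (subst (k * 2 ≤_) (sym (count-block-selfInverse a∼a⁻¹)) 2k≤∣H∣)
  ...   | S , S? , closedS , S⊆block , countS = record
          { S = S ; S? = S? ; closed = closedS ; ⊆block = S⊆block
          ; count-∩-coset = trans (count-cong (S? ∩? (a ∼?_)) S? proj₁
                                     λ Sx → Sx , [ id , ∼-trans a∼a⁻¹ ] (S⊆block Sx))
                                  countS }
  selection a | no a≁a⁻¹
    with closed-even-subset (a ≃?_) (λ _ → ≃-⁻¹) (k + k)
           (subst₂ _≤_ (sym (*-distribʳ-+ 2 k k)) (sym (count-block-¬selfInverse a≁a⁻¹))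
                   (+-mono-≤ 2k≤∣H∣ 2k≤∣H∣))
  ...   | S , S? , closedS , S⊆block , countS = record
          { S = S ; S? = S? ; closed = closedS ; ⊆block = S⊆block
          ; count-∩-coset = halve (trans (sym (count-two-coset-block S? closedS a≁a⁻¹ S⊆block))
                                         (trans countS (*-distribʳ-+ 2 k k))) }
    where
    halve : ∀ {x y} → x + x ≡ y + y → x ≡ y
    halve {x} {y} eq = trans (n≡⌊n+n/2⌋ x) (trans (cong ⌊_/2⌋ eq) (sym (n≡⌊n+n/2⌋ y)))

  open Representative ≃-isEquivalence _≃?_
  open Selection

  X : Pred (Fin n) 0ℓ
  X y = y ∉ H × S (selection (rep y)) y

  X? : Decidable X
  X? y = ¬? (y ∈? H) ×-dec S? (selection (rep y)) y

  rep-⁻¹ : ∀ y → rep y ≡ rep (y ⁻¹)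
  rep-⁻¹ y = rep-cong (≃-⁻¹ (inj₁ ∼-refl))

  X-connection : IsConnectionSet G (toSubset X?)
  X-connection = record
    { ε∉X        = λ ε∈X → proj₁ (∈-toSubset⁻ X? ε∈X) ε∈H
    ; inv-closed = λ {y} y∈X → ∈-toSubset⁺ X? (X-⁻¹ y (∈-toSubset⁻ X? y∈X))
    }
    where
    X-⁻¹ : ∀ y → X y → X (y ⁻¹)
    X-⁻¹ y (y∉H , Sy) = y∉H ∘ ∈-⁻¹ ,
      subst (λ r → S (selection r) (y ⁻¹)) (rep-⁻¹ y) (closed (selection (rep y)) y Sy)

  count-coset-∩-X : ∀ a → a ∉ H → count ((a ∼?_) ∩? X?) ≡ k * 2
  count-coset-∩-X a a∉H = begin
    count ((a ∼?_) ∩? X?)              ≡⟨ count-cong ((a ∼?_) ∩? X?) (S? sel ∩? (a ∼?_)) to from ⟩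
    count (S? sel ∩? (a ∼?_))          ≡⟨ count-∩-block-cong (S? sel) (closed sel) (rep-related a) ⟩
    count (S? sel ∩? (rep a ∼?_))      ≡⟨ count-∩-coset sel ⟩
    k * 2                              ∎
    where
    open ≡-Reasoning
    sel : Selection (rep a)
    sel = selection (rep a)
    to : (a ∼_) ∩ X ⊆ S sel ∩ (a ∼_)
    to {y} (a∼y , _ , Sy) = subst (λ r → S (selection r) y) (sym (rep-cong (inj₁ a∼y))) Sy , a∼y
    from : S sel ∩ (a ∼_) ⊆ (a ∼_) ∩ X
    from {y} (Sy , a∼y) = a∼y , (λ y∈H → a∉H (∼-∈ (∼-sym a∼y) y∈H)) ,
                          subst (λ r → S (selection r) y) (rep-cong (inj₁ a∼y)) Sy

  count-coset-∩-X≡0 : ∀ a → a ∈ H → count ((a ∼?_) ∩? X?) ≡ 0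
  count-coset-∩-X≡0 a a∈H = count-∅ ((a ∼?_) ∩? X?) λ y (a∼y , y∉H , _) → y∉H (∼-∈ a∼y a∈H)

  H-regular : IsRegularSetOfCay G (toSubset X?) 0 (k * 2) H
  H-regular g =
    (λ g∈H → trans (neighbours-in-H X? g) (count-coset-∩-X≡0 (g ⁻¹) (⁻¹-closed g∈H))) ,
    (λ g∉H → trans (neighbours-in-H X? g) (count-coset-∩-X (g ⁻¹) (g∉H ∘ ∈-⁻¹)))

lemma2p1 : (n : ℕ) (G : FinGroup n) (H : Subset n) → IsNormalSubgroup G H → NonTrivial G H →
    (τ : ℕ) → 1 ≤ τ → τ ≤ ∣ H ∣ → 2 ∣ τ → IsRegularSetOfGroup G 0 τ H
lemma2p1 n G H H-normal _ τ _ τ≤∣H∣ (divides k refl) = toSubset X? , X-connection , H-regular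
  where open Construction G H-normal k τ≤∣H∣
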